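{- Let $k\ge 0$ and let $V_u^k=\{v_1<v_2<\dots<v_m\}$ in lexicographic order. Then (i) $C_k=\bigsqcup_{v\in V_u^k}C_k^{v}$; (ii) the map $\varphi_k:C_k\to\{b_{v_1}>b_{v_2}>\dots>b_{v_m}\}$ (a chain) defined by $\varphi_k^{ -1}(b_{v_s})=C_k^{v_s}$ for $s\in[m]$ is order-preserving with respect to inclusion on $C_k$.
   Context: For a positive integer $n$, $[n]=\{1,\dots,n\}$. $KG_{3,k}$ has as vertices the $3$-element subsets of $[k+6]$, adjacent iff disjoint. A vertex $v$ is stable if there is no $t\in[k+6]$ with $\{t,t+1\}\subseteq v$ (addition mod $k+6$), unstable otherwise; $V_u^k$ is the set of unstable vertices, each written as a triple $s_1s_2s_3$ with $s_1<s_2<s_3$ and ordered lexicographically. $S_{3,k}$ has the same vertices as $KG_{3,k}$ and the edges of $KG_{3,k}$ with at least one stable endpoint; $\mathcal{N}(S_{3,k})$ is its neighborhood complex (simplices: nonempty vertex sets with a common neighbor in $S_{3,k}$). $C_k=\{\sigma\in\mathcal{N}(S_{3,k}) : \sigma\cap V_u^k\neq\emptyset\}$, and for $v\in V_u^k$, $C_k^{v}=\{\sigma\in C_k : v\in\sigma \text{ and } v'\notin\sigma \text{ for all } v'\in V_u^k \text{ with } v'<v\}$. -}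

module Defs where

open import Data.Nat using (ℕ; suc; _+_; _≤_; _<_)
open import Data.Bool using (Bool; true; false)
open import Data.Product using (Σ; ∃; _×_; _,_)
open import Data.Sum using (_⊎_)
open import Data.Empty using (⊥)
open import Relation.Nullary using (¬_)
open import Relation.Binary.PropositionalEquality using (_≡_)

-- Vertices of KG_{3,k}: 3-element subsets {s₁ < s₂ < s₃} of [k+6] = {1,…,k+6}.
record Vertex (k : ℕ) : Set where
  constructor vtx
  field
    s₁ s₂ s₃ : ℕ
    1≤s₁  : 1 ≤ s₁
    s₁<s₂ : s₁ < s₂
    s₂<s₃ : s₂ < s₃
    s₃≤   : s₃ ≤ k + 6
open Vertex public

_∈ᵥ_ : {k : ℕ} → ℕ → Vertex k → Set
t ∈ᵥ v = (t ≡ s₁ v) ⊎ (t ≡ s₂ v) ⊎ (t ≡ s₃ v)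

-- adjacency in KG_{3,k}: disjointness
Disjoint : {k : ℕ} → Vertex k → Vertex k → Set
Disjoint v w = ∀ t → t ∈ᵥ v → ¬ (t ∈ᵥ w)

-- successor modulo k+6 on [k+6] = {1,…,k+6}: k+6 ↦ 1, t ↦ t+1 otherwise
-- (we express "t+1 mod (k+6)" as a relation to avoid case splits)
SuccMod : ℕ → ℕ → ℕ → Set
SuccMod k t t' = (t < k + 6 × t' ≡ suc t) ⊎ (t ≡ k + 6 × t' ≡ 1)

Unstable : {k : ℕ} → Vertex k → Set
Unstable {k} v = Σ ℕ λ t → Σ ℕ λ t' →
  1 ≤ t × t ≤ k + 6 × SuccMod k t t' × t ∈ᵥ v × t' ∈ᵥ v

Stable : {k : ℕ} → Vertex k → Set
Stable v = ¬ Unstable v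

EdgeS : {k : ℕ} → Vertex k → Vertex k → Set
EdgeS v w = Disjoint v w × (Stable v ⊎ Stable w)

_<lex_ : {k : ℕ} → Vertex k → Vertex k → Set
v <lex w = (s₁ v < s₁ w)
         ⊎ (s₁ v ≡ s₁ w × s₂ v < s₂ w)
         ⊎ (s₁ v ≡ s₁ w × s₂ v ≡ s₂ w × s₃ v < s₃ w)

_≤lex_ : {k : ℕ} → Vertex k → Vertex k → Set
v ≤lex w = v ≡ w ⊎ v <lex w

-- a (candidate) simplex: a set of vertices, given by its characteristic function
-- (the vertex set is finite, so every such set is finite)
VSet : ℕ → Set
VSet k = Vertex k → Bool

_∈ₛ_ : {k : ℕ} → Vertex k → VSet k → Set
v ∈ₛ σ = σ v ≡ true

_⊆ₛ_ : {k : ℕ} → VSet k → VSet k → Set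
σ ⊆ₛ τ = ∀ v → v ∈ₛ σ → v ∈ₛ τ

InN : {k : ℕ} → VSet k → Set
InN {k} σ = (Σ (Vertex k) λ v → v ∈ₛ σ)
          × (Σ (Vertex k) λ w → ∀ v → v ∈ₛ σ → EdgeS v w)

InC : {k : ℕ} → VSet k → Set
InC {k} σ = InN σ × (Σ (Vertex k) λ v → v ∈ₛ σ × Unstable v)

InCv : {k : ℕ} → Vertex k → VSet k → Set
InCv {k} v σ = InC σ × v ∈ₛ σ
             × (∀ (v' : Vertex k) → Unstable v' → v' <lex v → σ v' ≡ false)

-- The chain {b_{v₁} > b_{v₂} > … > b_{v_m}} indexed by unstable vertices:
-- b_v ≤ b_w  iff  w ≤lex v.
_≤b_ : {k : ℕ} → Vertex k → Vertex k → Set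
v ≤b w = w ≤lex v

module Submission where

-- A simplex σ ∈ C_k contains an unstable
-- vertex, so it has a lexicographically least one, v; and σ ∈ C_k^w says
-- precisely that w is this least unstable vertex of σ.  Hence
--   (i)  every σ ∈ C_k lies in C_k^v for its first unstable vertex v, and it
--        lies in no other C_k^w, since two "first" vertices cannot be strictly
--        lex-ordered and the lex order is trichotomous;
--   (ii) if σ ⊆ τ then the first unstable vertex v of σ is an unstable vertex
--        of τ, so it does not precede the first unstable vertex w of τ,
--        i.e. w ≤lex v, which is b_v ≤ b_w.
-- The only real work is the existence of a least element, which needs the
-- lex order to be well founded and the relevant existential statements to be
-- decidable.

open import Defs
open import Data.Nat using (ℕ; suc; _+_; _≤_; _<_; _≤?_; _<?_; _≟_; s≤s; anyUpTo?)
open import Data.Nat.Properties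
  using (≤-irrelevant; <-cmp; <-trans; <-≤-trans; <⇒≤)
open import Data.Nat.Induction using (<-wellFounded)
open import Data.Bool using (true; false) renaming (_≟_ to _≟ᵇ_)
open import Data.Bool.Properties using (¬-not; not-¬)
open import Data.Product using (Σ; ∃; _×_; _,_; proj₁)
open import Data.Product.Relation.Binary.Lex.Strict using (×-Lex; ×-wellFounded)
open import Data.Sum using (_⊎_; inj₁; inj₂)
open import Function using (_on_)
open import Induction.WellFounded using (WellFounded; Acc; acc; module Subrelation)
open import Level using (0ℓ)
open import Relation.Binary.Core using (Rel)
open import Relation.Binary.Definitions using (tri<; tri≈; tri>)
import Relation.Binary.Construct.On as On
open import Relation.Binary.PropositionalEquality using (_≡_; refl; sym; trans; subst; cong₂)
open import Relation.Nullary using (¬_; Dec; yes; no; contradiction)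
open import Relation.Nullary.Decidable using (map′; _×-dec_; _⊎-dec_)
open import Relation.Unary using (Pred; Decidable)

module _ {A : Set} {_≺_ : Rel A 0ℓ} (wf : WellFounded _≺_) {P : Pred A 0ℓ}
         (below? : ∀ y → Dec (∃ λ x → P x × x ≺ y)) where

  minimal : ∀ {x} → P x → ∃ λ m → P m × (∀ y → P y → ¬ y ≺ m)
  minimal {x} px = go x px (wf x)
    where
    go : ∀ x → P x → Acc _≺_ x → ∃ λ m → P m × (∀ y → P y → ¬ y ≺ m)
    go x px (acc rec) with below? x
    ... | yes (y , py , y≺x) = go y py (rec y≺x)
    ... | no none            = x , px , λ y py y≺x → none (y , py , y≺x)

∃-bounded? : {P : Pred ℕ 0ℓ} → Decidable P → (m : ℕ) → (∀ {n} → P n → n < m) → Dec (∃ P)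
∃-bounded? P? m bound =
  map′ (λ (n , _ , pn) → n , pn) (λ (n , pn) → n , bound pn , pn) (anyUpTo? P? m)

module _ {k : ℕ} where

  -- The triple s₁s₂s₃ of a vertex; it determines the vertex, since the
  -- remaining fields are proofs of ≤, which are unique.
  coords : Vertex k → ℕ × ℕ × ℕ
  coords v = s₁ v , s₂ v , s₃ v

  coords-injective : ∀ {v w} → coords v ≡ coords w → v ≡ w
  coords-injective {vtx _ _ _ p q r s} {vtx _ _ _ p' q' r' s'} refl
    rewrite ≤-irrelevant p p' | ≤-irrelevant q q' | ≤-irrelevant r r' | ≤-irrelevant s s'
    = refl

  ∈ᵥ-bounded : ∀ {t} (v : Vertex k) → t ∈ᵥ v → t < suc (k + 6)
  ∈ᵥ-bounded v (inj₁ refl)        = s≤s (<⇒≤ (<-trans (s₁<s₂ v) (<-≤-trans (s₂<s₃ v) (s₃≤ v))))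
  ∈ᵥ-bounded v (inj₂ (inj₁ refl)) = s≤s (<⇒≤ (<-≤-trans (s₂<s₃ v) (s₃≤ v)))
  ∈ᵥ-bounded v (inj₂ (inj₂ refl)) = s≤s (s₃≤ v)

  vertex-at? : ∀ a b c → Dec (∃ λ v → coords v ≡ (a , b , c))
  vertex-at? a b c =
    map′ (λ (p , q , r , s) → vtx a b c p q r s , refl)
         (λ { (vtx _ _ _ p q r s , refl) → p , q , r , s })
         ((1 ≤? a) ×-dec (a <? b) ×-dec (b <? c) ×-dec (c ≤? k + 6))

  ∃-vertex? : {Q : Pred (Vertex k) 0ℓ} → Decidable Q → Dec (∃ Q)
  ∃-vertex? {Q} Q? =
    map′ (λ (_ , _ , _ , v , _ , qv) → v , qv)
         (λ (v , qv) → s₁ v , s₂ v , s₃ v , v , refl , qv)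
         (∃-bounded? (λ a → ∃-bounded? (λ b → ∃-bounded? (λ c → at? a b c)
            N bound₃) N bound₂) N bound₁)
    where
    N : ℕ
    N = suc (k + 6)

    At : ℕ → ℕ → ℕ → Set
    At a b c = ∃ λ v → coords v ≡ (a , b , c) × Q v

    at? : ∀ a b c → Dec (At a b c)
    at? a b c with vertex-at? a b c
    ... | no  none    = no λ (w , w≡ , _) → none (w , w≡)
    ... | yes (v , v≡) =
      map′ (λ qv → v , v≡ , qv)
           (λ (w , w≡ , qw) → subst Q (coords-injective (trans w≡ (sym v≡))) qw)
           (Q? v)

    bound₃ : ∀ {a b c} → At a b c → c < N
    bound₃ (v , refl , _) = ∈ᵥ-bounded v (inj₂ (inj₂ refl))

    bound₂ : ∀ {a b} → ∃ (At a b) → b < N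
    bound₂ (_ , v , refl , _) = ∈ᵥ-bounded v (inj₂ (inj₁ refl))

    bound₁ : ∀ {a} → ∃ (λ b → ∃ (At a b)) → a < N
    bound₁ (_ , _ , v , refl , _) = ∈ᵥ-bounded v (inj₁ refl)

  -- Instability is decidable: the witnesses t, t+1 are elements of v,
  -- hence bounded by k+6.
  unstable? : (v : Vertex k) → Dec (Unstable v)
  unstable? v =
    ∃-bounded? (λ t → ∃-bounded? (λ t' → (1 ≤? t) ×-dec (t ≤? k + 6) ×-dec succMod? t t'
                                    ×-dec ∈ᵥ? t ×-dec ∈ᵥ? t')
                 (suc (k + 6)) (λ (_ , _ , _ , _ , t'∈v) → ∈ᵥ-bounded v t'∈v))
      (suc (k + 6)) (λ (_ , _ , _ , _ , t∈v , _) → ∈ᵥ-bounded v t∈v)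
    where
    ∈ᵥ? : ∀ t → Dec (t ∈ᵥ v)
    ∈ᵥ? t = (t ≟ s₁ v) ⊎-dec (t ≟ s₂ v) ⊎-dec (t ≟ s₃ v)

    succMod? : ∀ t t' → Dec (SuccMod k t t')
    succMod? t t' = ((t <? k + 6) ×-dec (t' ≟ suc t)) ⊎-dec ((t ≟ k + 6) ×-dec (t' ≟ 1))

  _<lex?_ : (v w : Vertex k) → Dec (v <lex w)
  v <lex? w = (s₁ v <? s₁ w) ⊎-dec ((s₁ v ≟ s₁ w) ×-dec (s₂ v <? s₂ w))
              ⊎-dec ((s₁ v ≟ s₁ w) ×-dec (s₂ v ≟ s₂ w) ×-dec (s₃ v <? s₃ w))

  lex-trichotomy : (v w : Vertex k) → v <lex w ⊎ (v ≡ w ⊎ w <lex v)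
  lex-trichotomy v w with <-cmp (s₁ v) (s₁ w)
  ... | tri< a _ _ = inj₁ (inj₁ a)
  ... | tri> _ _ c = inj₂ (inj₂ (inj₁ c))
  ... | tri≈ _ e₁ _ with <-cmp (s₂ v) (s₂ w)
  ...   | tri< a _ _ = inj₁ (inj₂ (inj₁ (e₁ , a)))
  ...   | tri> _ _ c = inj₂ (inj₂ (inj₂ (inj₁ (sym e₁ , c))))
  ...   | tri≈ _ e₂ _ with <-cmp (s₃ v) (s₃ w)
  ...     | tri< a _ _ = inj₁ (inj₂ (inj₂ (e₁ , e₂ , a)))
  ...     | tri> _ _ c = inj₂ (inj₂ (inj₂ (inj₂ (sym e₁ , sym e₂ , c))))
  ...     | tri≈ _ e₃ _ = inj₂ (inj₁ (coords-injective (cong₂ _,_ e₁ (cong₂ _,_ e₂ e₃))))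

  -- ... and well founded, being contained in the (well-founded) strict
  -- lexicographic order on triples of naturals.
  <lex-wellFounded : WellFounded (_<lex_ {k})
  <lex-wellFounded =
    Subrelation.wellFounded (λ {v} {w} → into-×-Lex {v} {w})
      (On.wellFounded coords (×-wellFounded <-wellFounded (×-wellFounded <-wellFounded <-wellFounded)))
    where
    _<triple_ : Rel (ℕ × ℕ × ℕ) 0ℓ
    _<triple_ = ×-Lex _≡_ _<_ (×-Lex _≡_ _<_ _<_)

    into-×-Lex : ∀ {v w : Vertex k} → v <lex w → (_<triple_ on coords) v w
    into-×-Lex (inj₁ lt)                 = inj₁ lt
    into-×-Lex (inj₂ (inj₁ (e , lt)))    = inj₂ (e , inj₁ lt)
    into-×-Lex (inj₂ (inj₂ (e , e' , lt))) = inj₂ (e , inj₂ (e' , lt))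

  -- w is the first unstable vertex of σ, apart from w ∈ σ: no unstable
  -- vertex lexicographically before w lies in σ.  Note InCv w σ unfolds to
  -- InC σ × w ∈ₛ σ × NothingUnstableBefore w σ.
  NothingUnstableBefore : Vertex k → VSet k → Set
  NothingUnstableBefore w σ = ∀ v → Unstable v → v <lex w → σ v ≡ false

  first-unstable : (σ : VSet k) → (∃ λ v → v ∈ₛ σ × Unstable v) →
                   ∃ λ w → Unstable w × w ∈ₛ σ × NothingUnstableBefore w σ
  first-unstable σ (v , v∈σ , uv) =
    let w , (uw , w∈σ) , least = minimal <lex-wellFounded below? (uv , v∈σ)
    in  w , uw , w∈σ , λ u uu u<w → ¬-not (λ u∈σ → least u (uu , u∈σ) u<w)
    where
    below? : (w : Vertex k) → Dec (∃ λ u → (Unstable u × u ∈ₛ σ) × u <lex w)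
    below? w = ∃-vertex? (λ u → (unstable? u ×-dec (σ u ≟ᵇ true)) ×-dec (u <lex? w))

  not-before-first : (v w : Vertex k) (σ : VSet k) →
                     Unstable v → v ∈ₛ σ → NothingUnstableBefore w σ → ¬ v <lex w
  not-before-first v w σ uv v∈σ nothing v<w = not-¬ v∈σ (nothing v uv v<w)

proposition3p7 : (k : ℕ) →
    ((σ : VSet k) → InC σ → Σ (Vertex k) λ v → Unstable v × InCv v σ)
    × ((v : Vertex k) → Unstable v → (σ : VSet k) → InCv v σ → InC σ)
    × ((v w : Vertex k) → Unstable v → Unstable w → (σ : VSet k) →
    InCv v σ → InCv w σ → v ≡ w)
    × ((v w : Vertex k) → Unstable v → Unstable w → (σ τ : VSet k) →
    InCv v σ → InCv w τ → σ ⊆ₛ τ → v ≤b w)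
-- (i) covering, C_k^v ⊆ C_k (by definition), disjointness; (ii) monotonicity.
proposition3p7 k = covered , (λ _ _ _ → proj₁) , disjoint , monotone
  where
  covered : (σ : VSet k) → InC σ → Σ (Vertex k) λ v → Unstable v × InCv v σ
  covered σ σ∈C@(_ , unstable-member) with first-unstable σ unstable-member
  ... | v , uv , v∈σ , first = v , uv , σ∈C , v∈σ , first

  disjoint : (v w : Vertex k) → Unstable v → Unstable w → (σ : VSet k) →
             InCv v σ → InCv w σ → v ≡ w
  disjoint v w uv uw σ (_ , v∈σ , v-first) (_ , w∈σ , w-first) with lex-trichotomy v w
  ... | inj₁ v<w        = contradiction v<w (not-before-first v w σ uv v∈σ w-first)
  ... | inj₂ (inj₁ v≡w) = v≡w
  ... | inj₂ (inj₂ w<v) = contradiction w<v (not-before-first w v σ uw w∈σ v-first)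

  -- v ∈ σ ⊆ τ is an unstable vertex of τ, so it cannot precede w.
  monotone : (v w : Vertex k) → Unstable v → Unstable w → (σ τ : VSet k) →
             InCv v σ → InCv w τ → σ ⊆ₛ τ → v ≤b w
  monotone v w uv _ σ τ (_ , v∈σ , _) (_ , _ , w-first) σ⊆τ with lex-trichotomy v w
  ... | inj₁ v<w        = contradiction v<w (not-before-first v w τ uv (σ⊆τ v v∈σ) w-first)
  ... | inj₂ (inj₁ v≡w) = inj₁ (sym v≡w)
  ... | inj₂ (inj₂ w<v) = inj₂ w<v
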